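{- There exists a mesh pattern $(p,R)$ such that the set $\{R' : (p,R)\asymp(p,R')\}$, partially ordered by set containment, has no unique smallest element.
   Context: A mesh pattern is a pair $(p,R)$ where $p\in\mathfrak{S}_k$ and $R\subseteq\{0,\dots,k\}^2$, where $(a,b)\in R$ denotes the unit square $[a,a+1]\times[b,b+1]$ in $[0,k+1]^2$. A permutation $w\in\mathfrak{S}_n$ contains $(p,R)$ if there are indices $1\le i_1<\dots<i_k\le n$ with $w(i_1)\cdots w(i_k)$ order isomorphic to $p$ such that, setting $i_0=0$, $i_{k+1}=n+1$, $v_0=0$, $v_{k+1}=n+1$ and $v_b=w(i_{p^{ -1}(b)})$ for $b\in[1,k]$, for every $(a,b)\in R$ the open rectangle $(i_a,i_{a+1})\times(v_b,v_{b+1})$ contains no point $(x,w(x))$, $x\in[1,n]$. Otherwise $w$ avoids $(p,R)$. $\mathrm{Av}(\pi)$ is the set of permutations (of all sizes) avoiding $\pi$. Two mesh patterns $\pi,\sigma$ are coincident, written $\pi\asymp\sigma$, if $\mathrm{Av}(\pi)=\mathrm{Av}(\sigma)$. -}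

module Defs where

open import Data.Nat as ℕ using (ℕ; zero; suc)
open import Data.Fin as Fin using (Fin; zero; suc; toℕ; inject₁)
open import Data.Fin.Permutation using (Permutation′; _⟨$⟩ʳ_; _⟨$⟩ˡ_)
open import Data.Bool using (Bool; true)
open import Data.Product using (Σ; _×_; _,_)
open import Relation.Binary.PropositionalEquality using (_≡_)
open import Relation.Nullary using (¬_)
open import Function.Bundles using (_⇔_)

-- A shading R ⊆ {0,…,k}²: R a b ≡ true  means the box (a,b) is shaded.
Shading : ℕ → Set
Shading k = Fin (suc k) → Fin (suc k) → Bool

record MeshPattern (k : ℕ) : Set where
  constructor _,_
  field
    perm  : Permutation′ k
    shade : Shading k
open MeshPattern public

_⊆ˢ_ : ∀ {k} → Shading k → Shading k → Set
R ⊆ˢ R' = ∀ a b → R a b ≡ true → R' a b ≡ true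

ext : ∀ {k} → (Fin k → ℕ) → ℕ → Fin (suc k) → ℕ
ext {zero}  f m zero    = m
ext {suc k} f m zero    = f zero
ext {suc k} f m (suc i) = ext (λ j → f (suc j)) m i

-- bnd f n : Fin (k+2) → ℕ  is  0, f(0),…,f(k-1), n+1   (the sequences i_0..i_{k+1}, v_0..v_{k+1})
bnd : ∀ {k} → (Fin k → ℕ) → ℕ → Fin (suc (suc k)) → ℕ
bnd f n zero    = 0
bnd f n (suc i) = ext f (suc n) i

-- An occurrence of the mesh pattern (p , R) in w ∈ 𝔖_n, using 1-based
-- coordinates as in the paper: index j : Fin n is position toℕ j + 1 and
-- the point (x , w(x)) is (toℕ j + 1 , toℕ (w j) + 1).
record Occurrence {n k : ℕ} (w : Permutation′ n) (π : MeshPattern k) : Set where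
  field
    ι       : Fin k → Fin n
    incr    : ∀ a b → a Fin.< b → ι a Fin.< ι b
    orderIso : ∀ a b → (w ⟨$⟩ʳ ι a Fin.< w ⟨$⟩ʳ ι b) ⇔ (perm π ⟨$⟩ʳ a Fin.< perm π ⟨$⟩ʳ b)
  I : Fin k → ℕ
  I a = suc (toℕ (ι a))
  V : Fin k → ℕ
  V b = suc (toℕ (w ⟨$⟩ʳ ι (perm π ⟨$⟩ˡ b)))
  field
    empty : ∀ (a b : Fin (suc k)) → shade π a b ≡ true →
            ¬ (Σ (Fin n) λ j →
                 (bnd I n (inject₁ a) ℕ.< suc (toℕ j) × suc (toℕ j) ℕ.< bnd I n (suc a)) ×
                 (bnd V n (inject₁ b) ℕ.< suc (toℕ (w ⟨$⟩ʳ j)) × suc (toℕ (w ⟨$⟩ʳ j)) ℕ.< bnd V n (suc b)))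

Contains : ∀ {n k} → Permutation′ n → MeshPattern k → Set
Contains w π = Occurrence w π

Avoids : ∀ {n k} → Permutation′ n → MeshPattern k → Set
Avoids w π = ¬ Contains w π

_≍_ : ∀ {k l} → MeshPattern k → MeshPattern l → Set
π ≍ σ = ∀ (n : ℕ) (w : Permutation′ n) → Avoids w π ⇔ Avoids w σ

-- Witness: p = 12 with the two shadings
--   R₁ = {(0,1),(0,2),(1,1),(1,2),(2,0)}  and  R₂ = {(0,2),(1,0),(1,1),(2,0),(2,1)}.
-- Both (12,R₁) and (12,R₂) occur in w exactly when w is a sum α ⊕ β of two nonempty
-- permutations, so they are coincident.  The permutation 2413 is sum-indecomposable,
-- hence avoids (12,R₁), yet it contains (12, R₁ ∩ R₂).  A least shading R₀ coincident
-- with R₁ would satisfy R₀ ⊆ R₁ ∩ R₂, and since shading less only makes containment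
-- easier, 2413 would contain (12,R₀) while avoiding (12,R₁): a contradiction.
module Submission where

open import Defs
open import Data.Nat using (ℕ)
open import Data.Fin.Permutation using (Permutation′)
open import Data.Product using (Σ; _×_; _,_)
open import Relation.Nullary using (¬_)

open import Data.Nat using (zero; suc; pred; z≤n; s≤s; z<s; s<s; s<s⁻¹; s≤s⁻¹; _≤_; _<_)
open import Data.Nat.Properties
  using (<-cmp; <-irrefl; <-asym; <-trans; ≤-<-trans; <-≤-trans; ≤-reflexive; <⇒≤; <⇒≤pred;
         <⇒≱; ≮⇒≥; ≰⇒>; n<1+n; n≮0; _≤?_)
open import Data.Fin as Fin using (Fin; zero; suc; toℕ; fromℕ<; inject₁)
open import Data.Fin.Properties using (toℕ-injective; toℕ<n; toℕ-fromℕ<)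
open import Data.Fin.Permutation using (_⟨$⟩ʳ_; _⟨$⟩ˡ_; inverseˡ; inverseʳ; permutation)
import Data.Fin.Permutation as Permutation
open import Data.Empty using (⊥; ⊥-elim)
open import Data.Bool using (true; false; _∧_)
open import Relation.Binary.PropositionalEquality using (_≡_; refl; sym; trans; cong; cong₂; subst)
open import Relation.Binary.Definitions using (tri<; tri≈; tri>)
open import Relation.Nullary using (Dec; yes; no)
open import Function.Bundles using (_⇔_; mk⇔; Equivalence)

contains-antitone : ∀ {n k} {p : Permutation′ k} {R R' : Shading k} (w : Permutation′ n) →
                    R ⊆ˢ R' → Contains w (p , R') → Contains w (p , R)
contains-antitone w R⊆R' O = record
  { ι = ι ; incr = incr ; orderIso = orderIso
  ; empty = λ a b shaded → empty a b (R⊆R' a b shaded) }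
  where open Occurrence O

≍-refl : ∀ {k} (π : MeshPattern k) → π ≍ π
≍-refl π n w = mk⇔ (λ avoids → avoids) (λ avoids → avoids)

_∩ˢ_ : ∀ {k} → Shading k → Shading k → Shading k
(R ∩ˢ R') a b = R a b ∧ R' a b

⊆-∩ˢ : ∀ {k} {R₀ R R' : Shading k} → R₀ ⊆ˢ R → R₀ ⊆ˢ R' → R₀ ⊆ˢ (R ∩ˢ R')
⊆-∩ˢ R₀⊆R R₀⊆R' a b shaded = cong₂ _∧_ (R₀⊆R a b shaded) (R₀⊆R' a b shaded)

-- A least shading coincident with R would lie below both R and any coincident R',
-- hence below R ∩ R'; so a permutation avoiding (p, R) but containing (p, R ∩ R')
-- rules it out.
no-least-coincident-shading :
  ∀ {k n} {p : Permutation′ k} {R R' : Shading k} → (p , R) ≍ (p , R') →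
  (w : Permutation′ n) → Avoids w (p , R) → Contains w (p , R ∩ˢ R') →
  ¬ (Σ (Shading k) λ R₀ → ((p , R) ≍ (p , R₀)) × (∀ R'' → (p , R) ≍ (p , R'') → R₀ ⊆ˢ R''))
no-least-coincident-shading {p = p} {R} {R'} R≍R' w avoids contains (R₀ , R≍R₀ , least) =
  Equivalence.to (R≍R₀ _ w) avoids (contains-antitone w R₀⊆R∩R' contains)
  where
  R₀⊆R∩R' : R₀ ⊆ˢ (R ∩ˢ R')
  R₀⊆R∩R' = ⊆-∩ˢ (least R (≍-refl (p , R))) (least R' R≍R')

12ᵖ : Permutation′ 2
12ᵖ = Permutation.id

Strip : ℕ → ℕ → Fin 3 → ℕ → Set
Strip s s' zero             t = t < s
Strip s s' (suc zero)       t = s < t × t < s'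
Strip s s' (suc (suc zero)) t = s' < t

-- For a pattern of length 2 the window conditions of Defs (1-based, with the
-- sentinels 0 and n+1) are exactly the strips of the two 0-based cut points g.
strip-from-window : ∀ (g : Fin 2 → ℕ) n a t →
  bnd (λ i → suc (g i)) n (inject₁ a) < suc t × suc t < bnd (λ i → suc (g i)) n (suc a) →
  Strip (g zero) (g (suc zero)) a t
strip-from-window g n zero             t (_  , hi) = s<s⁻¹ hi
strip-from-window g n (suc zero)       t (lo , hi) = s<s⁻¹ lo , s<s⁻¹ hi
strip-from-window g n (suc (suc zero)) t (lo , _)  = s<s⁻¹ lo

window-from-strip : ∀ (g : Fin 2 → ℕ) n a t → t < n → Strip (g zero) (g (suc zero)) a t →
  bnd (λ i → suc (g i)) n (inject₁ a) < suc t × suc t < bnd (λ i → suc (g i)) n (suc a)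
window-from-strip g n zero             t _   t<s        = z<s , s<s t<s
window-from-strip g n (suc zero)       t _   (s<t , t<s') = s<s s<t , s<s t<s'
window-from-strip g n (suc (suc zero)) t t<n s'<t       = s<s s'<t , s<s t<n

≤pred⇒< : ∀ {t y} → 0 < y → t ≤ pred y → t < y
≤pred⇒< {y = suc _} _ t≤ = s≤s t≤

≥⇒pred< : ∀ {t y} → 0 < y → y ≤ t → pred y < t
≥⇒pred< {y = suc _} _ y≤t = y≤t

suc-pred< : ∀ {y m} → 0 < y → y < m → suc (pred y) < m
suc-pred< {y = suc _} _ y<m = y<m

pred<⇒≥ : ∀ {t y} → pred y < t → y ≤ t
pred<⇒≥ {y = zero}  _ = z≤n
pred<⇒≥ {y = suc _} y≤t = y≤t

R₁ : Shading 2
R₁ zero             (suc _) = true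
R₁ (suc zero)       (suc _) = true
R₁ (suc (suc zero)) zero    = true
R₁ _                _       = false

R₂ : Shading 2
R₂ zero    (suc (suc zero)) = true
R₂ (suc _) zero             = true
R₂ (suc _) (suc zero)       = true
R₂ _       _                = false

module _ {n : ℕ} (w : Permutation′ n) where

  W : Fin n → ℕ
  W j = toℕ (w ⟨$⟩ʳ j)

  W<n : ∀ j → W j < n
  W<n j = toℕ<n (w ⟨$⟩ʳ j)

  same-value : ∀ {j k} → W j ≡ W k → toℕ j ≡ toℕ k
  same-value {j} {k} e = cong toℕ j≡k
    where
    j≡k : j ≡ k
    j≡k = trans (sym (inverseˡ w)) (trans (cong (w ⟨$⟩ˡ_) (toℕ-injective e)) (inverseˡ w))

  same-position : ∀ {j k} → toℕ j ≡ toℕ k → W j ≡ W k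
  same-position e = cong W (toℕ-injective e)

  position-of : ∀ {v} → v < n → Fin n
  position-of v<n = w ⟨$⟩ˡ fromℕ< v<n

  W-position-of : ∀ {v} (v<n : v < n) → W (position-of v<n) ≡ v
  W-position-of v<n = trans (cong toℕ (inverseʳ w)) (toℕ-fromℕ< v<n)

  record Occurrence₁₂ (R : Shading 2) : Set where
    field
      first second : Fin n
      positions< : toℕ first < toℕ second
      values<    : W first < W second
      empty : ∀ a b j → R a b ≡ true →
              Strip (toℕ first) (toℕ second) a (toℕ j) → Strip (W first) (W second) b (W j) → ⊥

  occurrence₁₂ : ∀ {R} → Contains w (12ᵖ , R) → Occurrence₁₂ R
  occurrence₁₂ O = record
    { first = ι zero ; second = ι (suc zero)
    ; positions< = incr zero (suc zero) z<s
    ; values< = Equivalence.from (orderIso zero (suc zero)) z<s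
    ; empty = λ a b j shaded sa sb →
        empty a b shaded (j , window-from-strip _ n a (toℕ j) (toℕ<n j) sa
                            , window-from-strip _ n b (W j) (W<n j) sb) }
    where open Occurrence O

  contains₁₂ : ∀ {R} → Occurrence₁₂ R → Contains w (12ᵖ , R)
  contains₁₂ O = record
    { ι = ι
    ; incr = incr
    ; orderIso = orderIso
    ; empty = λ a b shaded (j , cols , rows) →
        empty a b j shaded (strip-from-window _ n a (toℕ j) cols) (strip-from-window _ n b (W j) rows) }
    where
    open Occurrence₁₂ O
    ι : Fin 2 → Fin n
    ι zero       = first
    ι (suc zero) = second
    incr : ∀ a b → a Fin.< b → ι a Fin.< ι b
    incr zero       (suc zero) _         = positions<
    incr (suc zero) (suc zero) (s<s ())
    orderIso : ∀ a b → (w ⟨$⟩ʳ ι a Fin.< w ⟨$⟩ʳ ι b) ⇔ (12ᵖ ⟨$⟩ʳ a Fin.< 12ᵖ ⟨$⟩ʳ b)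
    orderIso zero       zero       = mk⇔ (λ v<v → ⊥-elim (<-irrefl refl v<v)) (λ ())
    orderIso zero       (suc zero) = mk⇔ (λ _ → z<s) (λ _ → values<)
    orderIso (suc zero) zero       = mk⇔ (λ v<v → ⊥-elim (<-asym values< v<v)) (λ ())
    orderIso (suc zero) (suc zero) = mk⇔ (λ v<v → ⊥-elim (<-irrefl refl v<v)) (λ { (s<s ()) })

  -- w is a direct sum α ⊕ β with α, β nonempty: the positions 0..p₀ (α) carry values
  -- at most v₀, the later positions (β) larger values, and neither block is everything.
  record Decomposition : Set where
    field
      p₀ v₀    : ℕ
      β-pos    : suc p₀ < n
      β-val    : suc v₀ < n
      α-lower  : ∀ j → toℕ j ≤ p₀ → W j ≤ v₀
      β-upper  : ∀ j → p₀ < toℕ j → v₀ < W j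

  module _ (O : Occurrence₁₂ R₁) where
    open Occurrence₁₂ O

    private
      x y X Y : ℕ
      x = toℕ first
      y = toℕ second
      X = W first
      Y = W second

    before-second : ∀ j → toℕ j < y → W j ≤ X
    before-second j j<y with <-cmp X (W j)
    ... | tri> _ _ Wj<X = <⇒≤ Wj<X
    ... | tri≈ _ X≡Wj _ = ≤-reflexive (sym X≡Wj)
    ... | tri< X<Wj _ _ with <-cmp (toℕ j) x | <-cmp (W j) Y
    ...   | tri≈ _ j≡x _ | _ = ⊥-elim (<-irrefl (sym (same-position j≡x)) X<Wj)
    ...   | _ | tri≈ _ Wj≡Y _ = ⊥-elim (<-irrefl (same-value Wj≡Y) j<y)
    ...   | tri< j<x _ _ | tri< Wj<Y _ _ = ⊥-elim (empty zero (suc zero) j refl j<x (X<Wj , Wj<Y))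
    ...   | tri< j<x _ _ | tri> _ _ Y<Wj = ⊥-elim (empty zero (suc (suc zero)) j refl j<x Y<Wj)
    ...   | tri> _ _ x<j | tri< Wj<Y _ _ = ⊥-elim (empty (suc zero) (suc zero) j refl (x<j , j<y) (X<Wj , Wj<Y))
    ...   | tri> _ _ x<j | tri> _ _ Y<Wj = ⊥-elim (empty (suc zero) (suc (suc zero)) j refl (x<j , j<y) Y<Wj)

    from-second : ∀ j → y ≤ toℕ j → X < W j
    from-second j y≤j with <-cmp y (toℕ j)
    ... | tri≈ _ y≡j _ = subst (X <_) (same-position y≡j) values<
    ... | tri> _ _ j<y = ⊥-elim (<⇒≱ j<y y≤j)
    ... | tri< y<j _ _ with <-cmp X (W j)
    ...   | tri< X<Wj _ _ = X<Wj
    ...   | tri≈ _ X≡Wj _ = ⊥-elim (<-asym positions< (subst (y <_) (sym (same-value X≡Wj)) y<j))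
    ...   | tri> _ _ Wj<X = ⊥-elim (empty (suc (suc zero)) zero j refl y<j Wj<X)

    R₁-decomposition : Decomposition
    R₁-decomposition = record
      { p₀ = pred y ; v₀ = X
      ; β-pos = suc-pred< 0<y (toℕ<n second) ; β-val = ≤-<-trans values< (W<n second)
      ; α-lower = λ j j≤p₀ → before-second j (≤pred⇒< 0<y j≤p₀)
      ; β-upper = λ j p₀<j → from-second j (pred<⇒≥ p₀<j) }
      where
      0<y : 0 < y
      0<y = ≤-<-trans z≤n positions<

  module _ (O : Occurrence₁₂ R₂) where
    open Occurrence₁₂ O

    private
      x y X Y : ℕ
      x = toℕ first
      y = toℕ second
      X = W first
      Y = W second

    up-to-first : ∀ j → toℕ j ≤ x → W j < Y
    up-to-first j j≤x with <-cmp (toℕ j) x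
    ... | tri≈ _ j≡x _ = subst (_< Y) (sym (same-position j≡x)) values<
    ... | tri> _ _ x<j = ⊥-elim (<⇒≱ x<j j≤x)
    ... | tri< j<x _ _ with <-cmp (W j) Y
    ...   | tri< Wj<Y _ _ = Wj<Y
    ...   | tri≈ _ Wj≡Y _ = ⊥-elim (<-asym positions< (subst (_< x) (same-value Wj≡Y) j<x))
    ...   | tri> _ _ Y<Wj = ⊥-elim (empty zero (suc (suc zero)) j refl j<x Y<Wj)

    after-first : ∀ j → x < toℕ j → Y ≤ W j
    after-first j x<j with <-cmp (W j) Y
    ... | tri> _ _ Y<Wj = <⇒≤ Y<Wj
    ... | tri≈ _ Wj≡Y _ = ≤-reflexive (sym Wj≡Y)
    ... | tri< Wj<Y _ _ with <-cmp (toℕ j) y | <-cmp (W j) X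
    ...   | tri≈ _ j≡y _ | _ = ⊥-elim (<-irrefl (same-position j≡y) Wj<Y)
    ...   | _ | tri≈ _ Wj≡X _ = ⊥-elim (<-irrefl (sym (same-value Wj≡X)) x<j)
    ...   | tri< j<y _ _ | tri< Wj<X _ _ = ⊥-elim (empty (suc zero) zero j refl (x<j , j<y) Wj<X)
    ...   | tri< j<y _ _ | tri> _ _ X<Wj = ⊥-elim (empty (suc zero) (suc zero) j refl (x<j , j<y) (X<Wj , Wj<Y))
    ...   | tri> _ _ y<j | tri< Wj<X _ _ = ⊥-elim (empty (suc (suc zero)) zero j refl y<j Wj<X)
    ...   | tri> _ _ y<j | tri> _ _ X<Wj = ⊥-elim (empty (suc (suc zero)) (suc zero) j refl y<j (X<Wj , Wj<Y))

    R₂-decomposition : Decomposition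
    R₂-decomposition = record
      { p₀ = x ; v₀ = pred Y
      ; β-pos = ≤-<-trans positions< (toℕ<n second) ; β-val = suc-pred< 0<Y (W<n second)
      ; α-lower = λ j j≤x → <⇒≤pred (up-to-first j j≤x)
      ; β-upper = λ j x<j → ≥⇒pred< 0<Y (after-first j x<j) }
      where
      0<Y : 0 < Y
      0<Y = ≤-<-trans z≤n values<

  module _ (D : Decomposition) where
    open Decomposition D

    private
      stays-in-α : ∀ j → toℕ j ≤ p₀ → v₀ < W j → ⊥
      stays-in-α j j≤p₀ v₀<Wj = <⇒≱ v₀<Wj (α-lower j j≤p₀)

      stays-in-β : ∀ j → p₀ < toℕ j → W j ≤ v₀ → ⊥
      stays-in-β j p₀<j Wj≤v₀ = <⇒≱ (β-upper j p₀<j) Wj≤v₀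

      v₀<n : v₀ < n
      v₀<n = <-trans (n<1+n v₀) β-val

      p₀<n : p₀ < n
      p₀<n = <-trans (n<1+n p₀) β-pos

    -- (12, R₁) occurs as the largest value of α followed by the first entry of β.
    R₁-occurrence : Occurrence₁₂ R₁
    R₁-occurrence = record
      { first = top-α ; second = start-β
      ; positions< = top-α<start-β ; values< = Wtop-α<Wstart-β
      ; empty = empty }
      where
      top-α start-β : Fin n
      top-α   = position-of v₀<n
      start-β = fromℕ< β-pos

      Wtop-α : W top-α ≡ v₀
      Wtop-α = W-position-of v₀<n

      start-β≡ : toℕ start-β ≡ suc p₀
      start-β≡ = toℕ-fromℕ< β-pos

      left-of-start-β : ∀ j → toℕ j < toℕ start-β → toℕ j ≤ p₀
      left-of-start-β j j< = s≤s⁻¹ (subst (toℕ j <_) start-β≡ j<)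

      above-top-α : ∀ j → W top-α < W j → v₀ < W j
      above-top-α j = subst (_< W j) Wtop-α

      top-α<start-β : toℕ top-α < toℕ start-β
      top-α<start-β = subst (toℕ top-α <_) (sym start-β≡)
        (s≤s (≮⇒≥ (λ p₀<top → <-irrefl (sym Wtop-α) (β-upper top-α p₀<top))))

      p₀<start-β : p₀ < toℕ start-β
      p₀<start-β = subst (p₀ <_) (sym start-β≡) (n<1+n p₀)

      Wtop-α<Wstart-β : W top-α < W start-β
      Wtop-α<Wstart-β = subst (_< W start-β) (sym Wtop-α) (β-upper start-β p₀<start-β)

      empty : ∀ a b j → R₁ a b ≡ true → Strip (toℕ top-α) (toℕ start-β) a (toℕ j) →
              Strip (W top-α) (W start-β) b (W j) → ⊥
      empty zero (suc zero) j refl j<t (t<Wj , _) =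
        stays-in-α j (left-of-start-β j (<-trans j<t top-α<start-β)) (above-top-α j t<Wj)
      empty zero (suc (suc zero)) j refl j<t s<Wj =
        stays-in-α j (left-of-start-β j (<-trans j<t top-α<start-β)) (above-top-α j (<-trans Wtop-α<Wstart-β s<Wj))
      empty (suc zero) (suc zero) j refl (_ , j<s) (t<Wj , _) =
        stays-in-α j (left-of-start-β j j<s) (above-top-α j t<Wj)
      empty (suc zero) (suc (suc zero)) j refl (_ , j<s) s<Wj =
        stays-in-α j (left-of-start-β j j<s) (above-top-α j (<-trans Wtop-α<Wstart-β s<Wj))
      empty (suc (suc zero)) zero j refl s<j Wj<t =
        stays-in-β j (<-trans p₀<start-β s<j) (<⇒≤ (subst (W j <_) Wtop-α Wj<t))

    -- (12, R₂) occurs as the last entry of α followed by the smallest value of β.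
    R₂-occurrence : Occurrence₁₂ R₂
    R₂-occurrence = record
      { first = end-α ; second = bottom-β
      ; positions< = end-α<bottom-β ; values< = Wend-α<Wbottom-β
      ; empty = empty }
      where
      end-α bottom-β : Fin n
      end-α    = fromℕ< p₀<n
      bottom-β = position-of β-val

      end-α≡ : toℕ end-α ≡ p₀
      end-α≡ = toℕ-fromℕ< p₀<n

      Wbottom-β : W bottom-β ≡ suc v₀
      Wbottom-β = W-position-of β-val

      right-of-end-α : ∀ j → toℕ end-α < toℕ j → p₀ < toℕ j
      right-of-end-α j = subst (_< toℕ j) end-α≡

      below-bottom-β : ∀ j → W j < W bottom-β → W j ≤ v₀
      below-bottom-β j Wj< = s≤s⁻¹ (subst (W j <_) Wbottom-β Wj<)

      Wend-α≤v₀ : W end-α ≤ v₀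
      Wend-α≤v₀ = α-lower end-α (≤-reflexive end-α≡)

      end-α<bottom-β : toℕ end-α < toℕ bottom-β
      end-α<bottom-β = subst (_< toℕ bottom-β) (sym end-α≡)
        (≰⇒> (λ bottom≤p₀ → stays-in-α bottom-β bottom≤p₀ (subst (v₀ <_) (sym Wbottom-β) (n<1+n v₀))))

      Wend-α<Wbottom-β : W end-α < W bottom-β
      Wend-α<Wbottom-β = subst (W end-α <_) (sym Wbottom-β) (s≤s Wend-α≤v₀)

      empty : ∀ a b j → R₂ a b ≡ true → Strip (toℕ end-α) (toℕ bottom-β) a (toℕ j) →
              Strip (W end-α) (W bottom-β) b (W j) → ⊥
      empty zero (suc (suc zero)) j refl j<e b<Wj =
        stays-in-α j (<⇒≤ (subst (toℕ j <_) end-α≡ j<e)) (<-trans (n<1+n v₀) (subst (_< W j) Wbottom-β b<Wj))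
      empty (suc zero) zero j refl (e<j , _) Wj<We =
        stays-in-β j (right-of-end-α j e<j) (<⇒≤ (<-≤-trans Wj<We Wend-α≤v₀))
      empty (suc zero) (suc zero) j refl (e<j , _) (_ , Wj<Wb) =
        stays-in-β j (right-of-end-α j e<j) (below-bottom-β j Wj<Wb)
      empty (suc (suc zero)) zero j refl b<j Wj<We =
        stays-in-β j (right-of-end-α j (<-trans end-α<bottom-β b<j)) (<⇒≤ (<-≤-trans Wj<We Wend-α≤v₀))
      empty (suc (suc zero)) (suc zero) j refl b<j (_ , Wj<Wb) =
        stays-in-β j (right-of-end-α j (<-trans end-α<bottom-β b<j)) (below-bottom-β j Wj<Wb)

-- (12, R₁) and (12, R₂) are both contained in exactly the decomposable permutations.
R₁≍R₂ : (12ᵖ , R₁) ≍ (12ᵖ , R₂)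
R₁≍R₂ n w = mk⇔
  (λ avoids₁ contains₂ → avoids₁ (contains₁₂ w (R₁-occurrence w (R₂-decomposition w (occurrence₁₂ w contains₂)))))
  (λ avoids₂ contains₁ → avoids₂ (contains₁₂ w (R₂-occurrence w (R₁-decomposition w (occurrence₁₂ w contains₁)))))

-- The permutation 2413, written 0-based as 1 3 0 2.
2413ᵖ : Permutation′ 4
2413ᵖ = permutation to from to∘from from∘to
  where
  to from : Fin 4 → Fin 4
  to zero                   = suc zero
  to (suc zero)             = suc (suc (suc zero))
  to (suc (suc zero))       = zero
  to (suc (suc (suc zero))) = suc (suc zero)
  from zero                   = suc (suc zero)
  from (suc zero)             = zero
  from (suc (suc zero))       = suc (suc (suc zero))
  from (suc (suc (suc zero))) = suc zero
  to∘from : ∀ i → to (from i) ≡ i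
  to∘from zero                   = refl
  to∘from (suc zero)             = refl
  to∘from (suc (suc zero))       = refl
  to∘from (suc (suc (suc zero))) = refl
  from∘to : ∀ i → from (to i) ≡ i
  from∘to zero                   = refl
  from∘to (suc zero)             = refl
  from∘to (suc (suc zero))       = refl
  from∘to (suc (suc (suc zero))) = refl

-- 2413 is sum-indecomposable: a cut after position 0 or 1 leaves the value 0 in β,
-- a cut after position 2 leaves the value 3 in α but the value 2 in β.
2413-indecomposable : ¬ Decomposition 2413ᵖ
2413-indecomposable D = cut-after (p₀ ≤? 1)
  where
  open Decomposition D
  cut-after : Dec (p₀ ≤ 1) → ⊥
  cut-after (yes p₀≤1) = n≮0 (β-upper (suc (suc zero)) (s≤s p₀≤1))
  cut-after (no p₀≰1)  = <-asym (β-upper (suc (suc (suc zero))) (s≤s⁻¹ β-pos))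
                                (α-lower (suc zero) (<⇒≤ (≰⇒> p₀≰1)))

2413-contains-R₁∩R₂ : Contains 2413ᵖ (12ᵖ , R₁ ∩ˢ R₂)
2413-contains-R₁∩R₂ = contains₁₂ 2413ᵖ record
  { first = zero ; second = suc (suc (suc zero))
  ; positions< = s≤s z≤n ; values< = s≤s (s≤s z≤n)
  ; empty = empty }
  where
  nothing-between : ∀ {m t} → m < t → t < suc m → ⊥
  nothing-between m<t t<1+m = <⇒≱ m<t (s≤s⁻¹ t<1+m)

  empty : ∀ a b j → (R₁ ∩ˢ R₂) a b ≡ true → Strip 0 3 a (toℕ j) → Strip 1 2 b (W 2413ᵖ j) → ⊥
  empty zero             (suc (suc zero)) j refl ()
  empty (suc zero)       (suc zero)       j refl _ (1<Wj , Wj<2) = nothing-between 1<Wj Wj<2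
  empty (suc (suc zero)) zero             j refl 3<j _ = nothing-between 3<j (toℕ<n j)

corollary3p7 : Σ ℕ λ k → Σ (Permutation′ k) λ p → Σ (Shading k) λ R →
    ¬ (Σ (Shading k) λ R₀ →
         ((p , R) ≍ (p , R₀)) ×
         (∀ (R' : Shading k) → (p , R) ≍ (p , R') → R₀ ⊆ˢ R'))
corollary3p7 = 2 , 12ᵖ , R₁ ,
  no-least-coincident-shading R₁≍R₂ 2413ᵖ 2413-avoids-R₁ 2413-contains-R₁∩R₂
  where
  2413-avoids-R₁ : Avoids 2413ᵖ (12ᵖ , R₁)
  2413-avoids-R₁ contains = 2413-indecomposable (R₁-decomposition 2413ᵖ (occurrence₁₂ 2413ᵖ contains))
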